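{- Let $q$ be a prime power, let $1 \le \ell \le m-1$, let $V_m$ be an $m$-dimensional vector space over $\mathbb{F}_q$, and let $\Pi$ be a hyperplane of $\mathbb{P}\left(\bigwedge^{\ell} V_m\right)$. Let $a = \max_{V_{m-1}} |\Pi \cap G(\ell, V_{m-1})|$, the maximum taken over all $(m-1)$-dimensional subspaces $V_{m-1}$ of $V_m$. Then $$|G(\ell, V_m) \cap \Pi| \le a \,\frac{q^m - 1}{q^{m-\ell} - 1}.$$ Furthermore, if $|\Pi \cap G(\ell, V_{m-1})| = a$ for every $(m-1)$-dimensional subspace $V_{m-1}$ of $V_m$, then equality holds.
   Context: $G(\ell,V)$ denotes the Grassmannian of $\ell$-dimensional subspaces of a vector space $V$, identified with its image in $\mathbb{P}\left(\bigwedge^{\ell} V\right)$ under the Plücker embedding $L \mapsto [\omega_1 \wedge \cdots \wedge \omega_\ell]$ ($\omega_i$ a basis of $L$); for a subspace $V_{m-1}\subseteq V_m$, $G(\ell,V_{m-1})$ is regarded as a subset of $G(\ell,V_m)\subseteq \mathbb{P}\left(\bigwedge^\ell V_m\right)$. Cardinalities count points. -}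

module Defs where

open import Level using (Level; _⊔_) renaming (suc to lsuc)
open import Algebra.Bundles using (CommutativeRing)
open import Data.Nat as ℕ using (ℕ; zero; suc)
open import Data.Fin as Fin using (Fin; zero; suc; punchIn)
open import Data.Fin.Properties using (all?; any?)
open import Data.List as List using (List; []; _∷_; length; filter; map; concatMap; allFin; foldr)
open import Data.List.Membership.Propositional using (_∈_)
open import Data.List.Relation.Unary.Any as Any using (Any)
open import Data.List.Relation.Unary.AllPairs using (AllPairs)
open import Data.Product using (Σ; ∃; _×_; _,_)
open import Relation.Nullary using (¬_; Dec)
open import Relation.Nullary.Decidable using (_×-dec_; _→-dec_; ¬?)
open import Relation.Unary using (Decidable)
open import Relation.Binary using (Rel)
import Relation.Binary as B

-- Its cardinality q = length elems is then
-- automatically a prime power.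

record FiniteField (c ℓ : Level) : Set (lsuc (c ⊔ ℓ)) where
  field
    commRing  : CommutativeRing c ℓ
  open CommutativeRing commRing public hiding (zero)
  field
    0≉1       : ¬ (0# ≈ 1#)
    inverse   : ∀ x → ¬ (x ≈ 0#) → ∃ λ y → x * y ≈ 1#
    _≈?_      : B.Decidable _≈_
    elems     : List Carrier
    complete  : ∀ x → Any (x ≈_) elems
    distinct  : AllPairs (λ x y → ¬ (x ≈ y)) elems

  card : ℕ
  card = length elems

cons : ∀ {a} {A : Set a} {n} → A → (Fin n → A) → Fin (suc n) → A
cons x f zero    = x
cons x f (suc i) = f i

allFuns : ∀ {a} {A : Set a} (n : ℕ) → List A → List (Fin n → A)
allFuns zero    xs = (λ ()) ∷ []
allFuns (suc n) xs = concatMap (λ x → map (cons x) (allFuns n xs)) xs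

count : ∀ {a p} {A : Set a} {P : A → Set p} → Decidable P → List A → ℕ
count P? xs = length (filter P? xs)

-- ℓ-subsets of {0,…,m-1}, as strictly increasing maps Fin ℓ → Fin m.

Increasing : ∀ {ℓ m} → (Fin ℓ → Fin m) → Set
Increasing f = ∀ i j → i Fin.< j → f i Fin.< f j

increasing? : ∀ {ℓ m} → Decidable (Increasing {ℓ} {m})
increasing? f = all? λ i → all? λ j → (i Fin.<? j) →-dec (f i Fin.<? f j)

incMaps : (ℓ m : ℕ) → List (Fin ℓ → Fin m)
incMaps ℓ m = filter increasing? (allFuns ℓ (allFin m))

module LinAlg {c ℓ'} (F : FiniteField c ℓ') where
  open FiniteField F

  Vector : ℕ → Set c
  Vector m = Fin m → Carrier

  Matrix : ℕ → ℕ → Set c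
  Matrix k m = Fin k → Fin m → Carrier

  Σ[<_]_ : (n : ℕ) → (Fin n → Carrier) → Carrier
  Σ[< zero  ] f = 0#
  Σ[< suc n ] f = f zero + Σ[< n ] (λ i → f (suc i))

  sumList : ∀ {a} {A : Set a} → List A → (A → Carrier) → Carrier
  sumList xs f = foldr (λ x s → f x + s) 0# xs

  det : (n : ℕ) → Matrix n n → Carrier
  det zero    M = 1#
  det (suc n) M = Σ[< suc n ] λ j →
    sign j * (M zero j * det n (λ r s → M (suc r) (punchIn j s)))
    where
      sign : ∀ {k} → Fin k → Carrier
      sign zero    = 1#
      sign (suc i) = - sign i

  plucker : ∀ {ℓ m} → Matrix ℓ m → (Fin ℓ → Fin m) → Carrier
  plucker {ℓ} M I = det ℓ (λ r s → M r (I s))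

  -- a hyperplane Π of P(⋀^ℓ V_m), given by coefficients c_I (I an
  -- ℓ-subset of Fin m), not all zero; only increasing I are used.
  record Hyperplane (ℓ m : ℕ) : Set (c ⊔ ℓ') where
    field
      coeff   : (Fin ℓ → Fin m) → Carrier
      nonzero : Any (λ I → ¬ (coeff I ≈ 0#)) (incMaps ℓ m)

  InΠ : ∀ {ℓ m} → Hyperplane ℓ m → Matrix ℓ m → Set ℓ'
  InΠ {ℓ} {m} Π M =
    sumList (incMaps ℓ m) (λ I → Hyperplane.coeff Π I * plucker M I) ≈ 0#

  inΠ? : ∀ {ℓ m} (Π : Hyperplane ℓ m) → Decidable (InΠ Π)
  inΠ? Π M = _ ≈? 0#

  RREFWith : ∀ {ℓ m} → Matrix ℓ m → (Fin ℓ → Fin m) → Set ℓ'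
  RREFWith {ℓ} {m} M p =
    (∀ i → M i (p i) ≈ 1#) ×
    (∀ i (j : Fin m) → j Fin.< p i → M i j ≈ 0#) ×
    (∀ i i' → ¬ (i ≡ i') → M i' (p i) ≈ 0#)
    where open import Relation.Binary.PropositionalEquality using (_≡_)

  rrefWith? : ∀ {ℓ m} (M : Matrix ℓ m) → Decidable (RREFWith M)
  rrefWith? M p =
    (all? λ i → M i (p i) ≈? 1#) ×-dec
    ((all? λ i → all? λ j → (j Fin.<? p i) →-dec (M i j ≈? 0#)) ×-dec
     (all? λ i → all? λ i' → ¬? (i Fin.≟ i') →-dec (M i' (p i) ≈? 0#)))

  IsRREF : ∀ {ℓ m} → Matrix ℓ m → Set ℓ'
  IsRREF {ℓ} {m} M = Any (RREFWith M) (incMaps ℓ m)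

  isRREF? : ∀ {ℓ m} → Decidable (IsRREF {ℓ} {m})
  isRREF? M = Any.any? (rrefWith? M) (incMaps _ _)

  allMatrices : (ℓ m : ℕ) → List (Matrix ℓ m)
  allMatrices ℓ m = allFuns ℓ (allFuns m elems)

  -- ℓ-dimensional subspaces of F^m ↔ ℓ × m matrices in RREF (row space).
  -- |G(ℓ, V_m) ∩ Π|:
  gIntΠ : ∀ {ℓ m} → Hyperplane ℓ m → ℕ
  gIntΠ {ℓ} {m} Π =
    count (λ M → isRREF? M ×-dec inΠ? Π M) (allMatrices ℓ m)

  -- (m-1)-dimensional subspaces of F^m are kernels of nonzero functionals h
  NonzeroFunctional : ℕ → Set (c ⊔ ℓ')
  NonzeroFunctional m = Σ (Vector m) λ h → Any (λ j → ¬ (h j ≈ 0#)) (allFin m)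

  InKernel : ∀ {ℓ m} → Vector m → Matrix ℓ m → Set ℓ'
  InKernel {ℓ} {m} h M = ∀ r → Σ[< m ] (λ j → h j * M r j) ≈ 0#

  inKernel? : ∀ {ℓ m} (h : Vector m) → Decidable (InKernel {ℓ} {m} h)
  inKernel? h M = all? λ r → _ ≈? 0#

  gIntΠIn : ∀ {ℓ m} → Hyperplane ℓ m → Vector m → ℕ
  gIntΠIn {ℓ} {m} Π h =
    count (λ M → isRREF? M ×-dec (inΠ? Π M ×-dec inKernel? h M))
          (allMatrices ℓ m)

-- Double counting of the pairs (L, h) with L ∈ G(ℓ, V_m) ∩ Π and h a nonzero
-- linear form vanishing on L.  For fixed L the forms vanishing on L make up a
-- space of dimension m - ℓ, so L is counted q^(m-ℓ) - 1 times; for fixed h the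
-- count is |Π ∩ G(ℓ, ker h)| ≤ a, and there are q^m - 1 forms h.  Each
-- hyperplane is ker h for q - 1 forms h, which is why it is harmless to
-- range over forms instead of hyperplanes.  The dimension count is done column
-- by column on the echelon form of L: a pivot column determines the
-- corresponding coordinate of h from the later ones, a zero column leaves it free.

module Submission where

open import Defs
open import Level using (Level; _⊔_)
open import Data.Nat using (ℕ; _≤_; _*_; _∸_; _^_)
open import Data.Product using (_×_; ∃; proj₁)
open import Relation.Binary.PropositionalEquality using (_≡_)

open import Data.Bool using (true; false; if_then_else_)
open import Data.Empty using (⊥-elim)
open import Data.Nat using (zero; suc; _+_; _<_; z≤n; s≤s)
import Data.Nat.Properties as ℕ
open import Algebra.Properties.CommutativeSemigroup ℕ.+-commutativeSemigroup using (interchange)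
open import Data.Fin as Fin using (Fin)
open import Data.List using (List; []; _∷_; _++_; length; filter; map; concatMap; allFin)
open import Data.List.Membership.Propositional using (find; lose)
open import Data.List.Membership.Propositional.Properties using (∈-filter⁻; ∈-allFin)
open import Data.Fin.Properties using (all?)
open import Data.Unit using (tt)
open import Data.List.Relation.Unary.All as All using (All; []; _∷_)
open import Data.List.Relation.Unary.Any as Any using (Any; here; there)
open import Data.List.Relation.Unary.All.Properties using (all-filter)
open import Data.List.Relation.Unary.AllPairs using (AllPairs; []; _∷_)
open import Data.Product using (_,_; proj₂)
open import Function.Bundles using (_⇔_; mk⇔; Equivalence)
open import Relation.Nullary using (Dec; does; yes; no; ¬_)
open import Relation.Nullary.Decidable using (_×-dec_; ¬?; decidable-stable)
open import Relation.Unary using (Decidable)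
open import Relation.Binary.PropositionalEquality
  using (refl; sym; trans; cong; cong₂; subst; module ≡-Reasoning)
import Relation.Binary.Reasoning.Setoid

module _ {a} {A : Set a} where

  ∑ : List A → (A → ℕ) → ℕ
  ∑ []       f = 0
  ∑ (x ∷ xs) f = f x + ∑ xs f

  infix 5 ∑
  syntax ∑ xs (λ x → e) = ∑[ x ∈ xs ] e

  ∑-cong : ∀ xs {f g : A → ℕ} → (∀ x → f x ≡ g x) → ∑ xs f ≡ ∑ xs g
  ∑-cong []       f≡g = refl
  ∑-cong (x ∷ xs) f≡g = cong₂ _+_ (f≡g x) (∑-cong xs f≡g)

  ∑-cong-All : ∀ {xs} {f g : A → ℕ} → All (λ x → f x ≡ g x) xs → ∑ xs f ≡ ∑ xs g
  ∑-cong-All []           = refl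
  ∑-cong-All (fx≡gx ∷ eq) = cong₂ _+_ fx≡gx (∑-cong-All eq)

  ∑-mono-≤ : ∀ {xs} {f g : A → ℕ} → All (λ x → f x ≤ g x) xs → ∑ xs f ≤ ∑ xs g
  ∑-mono-≤ []           = z≤n
  ∑-mono-≤ (fx≤gx ∷ le) = ℕ.+-mono-≤ fx≤gx (∑-mono-≤ le)

  ∑-zero : ∀ xs → ∑[ x ∈ xs ] 0 ≡ 0
  ∑-zero []       = refl
  ∑-zero (x ∷ xs) = ∑-zero xs

  ∑-const : ∀ xs n → ∑[ x ∈ xs ] n ≡ length xs * n
  ∑-const []       n = refl
  ∑-const (x ∷ xs) n = cong (n +_) (∑-const xs n)

  ∑-++ : ∀ xs ys (f : A → ℕ) → ∑ (xs ++ ys) f ≡ ∑ xs f + ∑ ys f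
  ∑-++ []       ys f = refl
  ∑-++ (x ∷ xs) ys f = trans (cong (f x +_) (∑-++ xs ys f)) (sym (ℕ.+-assoc (f x) _ _))

  ∑-+ : ∀ xs (f g : A → ℕ) → ∑[ x ∈ xs ] (f x + g x) ≡ ∑ xs f + ∑ xs g
  ∑-+ []       f g = refl
  ∑-+ (x ∷ xs) f g = trans (cong (f x + g x +_) (∑-+ xs f g)) (interchange (f x) (g x) _ _)

  ∑-*ˡ : ∀ xs n (f : A → ℕ) → ∑[ x ∈ xs ] (n * f x) ≡ n * ∑ xs f
  ∑-*ˡ []       n f = sym (ℕ.*-zeroʳ n)
  ∑-*ˡ (x ∷ xs) n f = trans (cong (n * f x +_) (∑-*ˡ xs n f)) (sym (ℕ.*-distribˡ-+ n (f x) _))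

  ∑-*ʳ : ∀ xs n (f : A → ℕ) → ∑[ x ∈ xs ] (f x * n) ≡ ∑ xs f * n
  ∑-*ʳ xs n f = trans (∑-cong xs (λ x → ℕ.*-comm (f x) n)) (trans (∑-*ˡ xs n f) (ℕ.*-comm n _))

module _ {a b} {A : Set a} {B : Set b} where

  ∑-map : ∀ (g : A → B) xs (f : B → ℕ) → ∑ (map g xs) f ≡ ∑[ x ∈ xs ] f (g x)
  ∑-map g []       f = refl
  ∑-map g (x ∷ xs) f = cong (f (g x) +_) (∑-map g xs f)

  ∑-concatMap : ∀ (g : A → List B) xs (f : B → ℕ) →
    ∑ (concatMap g xs) f ≡ ∑[ x ∈ xs ] ∑ (g x) f
  ∑-concatMap g []       f = refl
  ∑-concatMap g (x ∷ xs) f =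
    trans (∑-++ (g x) (concatMap g xs) f) (cong (∑ (g x) f +_) (∑-concatMap g xs f))

  ∑-comm : ∀ xs ys (f : A → B → ℕ) →
    ∑[ x ∈ xs ] ∑ ys (f x) ≡ ∑[ y ∈ ys ] ∑[ x ∈ xs ] f x y
  ∑-comm []       ys f = sym (∑-zero ys)
  ∑-comm (x ∷ xs) ys f =
    trans (cong (∑ ys (f x) +_) (∑-comm xs ys f)) (sym (∑-+ ys (f x) _))

module _ {a} {A : Set a} where

  ∑-allFuns-suc : ∀ n xs (f : (Fin (suc n) → A) → ℕ) →
    ∑ (allFuns (suc n) xs) f ≡ ∑[ x ∈ xs ] ∑[ h ∈ allFuns n xs ] f (cons x h)
  ∑-allFuns-suc n xs f =
    trans (∑-concatMap _ xs f) (∑-cong xs (λ x → ∑-map (cons x) (allFuns n xs) f))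

  ∑-allFuns-1 : ∀ n (xs : List A) → ∑[ h ∈ allFuns n xs ] 1 ≡ length xs ^ n
  ∑-allFuns-1 zero    xs = refl
  ∑-allFuns-1 (suc n) xs = begin
    ∑[ h ∈ allFuns (suc n) xs ] 1        ≡⟨ ∑-allFuns-suc n xs _ ⟩
    ∑[ x ∈ xs ] ∑[ h ∈ allFuns n xs ] 1  ≡⟨ ∑-cong xs (λ _ → ∑-allFuns-1 n xs) ⟩
    ∑[ x ∈ xs ] length xs ^ n            ≡⟨ ∑-const xs _ ⟩
    length xs * length xs ^ n            ∎
    where open ≡-Reasoning

module _ {p} {P : Set p} where

  -- Through `does`, so that 𝟙 (yes p ×-dec Q?) reduces to 𝟙 Q?.
  𝟙 : Dec P → ℕ
  𝟙 P? = if does P? then 1 else 0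

  𝟙-yes : (P? : Dec P) → P → 𝟙 P? ≡ 1
  𝟙-yes (yes _)  _  = refl
  𝟙-yes (no ¬px) px = ⊥-elim (¬px px)

  𝟙-no : (P? : Dec P) → ¬ P → 𝟙 P? ≡ 0
  𝟙-no (yes px) ¬px = ⊥-elim (¬px px)
  𝟙-no (no _)   _   = refl

module _ {p q} {P : Set p} {Q : Set q} where

  𝟙-cong : (P? : Dec P) (Q? : Dec Q) → P ⇔ Q → 𝟙 P? ≡ 𝟙 Q?
  𝟙-cong (yes px) Q? P⇔Q = sym (𝟙-yes Q? (Equivalence.to P⇔Q px))
  𝟙-cong (no ¬px) Q? P⇔Q = sym (𝟙-no Q? (λ qx → ¬px (Equivalence.from P⇔Q qx)))

  𝟙-× : (P? : Dec P) (Q? : Dec Q) → 𝟙 (P? ×-dec Q?) ≡ 𝟙 P? * 𝟙 Q?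
  𝟙-× P? Q? with does P? | does Q?
  ... | true  | true  = refl
  ... | true  | false = refl
  ... | false | _     = refl

module _ {a p} {A : Set a} {P : A → Set p} (P? : Decidable P) where

  count≡∑𝟙 : ∀ xs → count P? xs ≡ ∑[ x ∈ xs ] 𝟙 (P? x)
  count≡∑𝟙 []       = refl
  count≡∑𝟙 (x ∷ xs) with does (P? x)
  ... | true  = cong suc (count≡∑𝟙 xs)
  ... | false = count≡∑𝟙 xs

  ∑-filter : ∀ xs (f : A → ℕ) → ∑ (filter P? xs) f ≡ ∑[ x ∈ xs ] 𝟙 (P? x) * f x
  ∑-filter []       f = refl
  ∑-filter (x ∷ xs) f with does (P? x)
  ... | true  = cong₂ _+_ (sym (ℕ.+-identityʳ (f x))) (∑-filter xs f)
  ... | false = ∑-filter xs f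

  ∑-𝟙-none : ∀ {xs} → All (λ x → ¬ P x) xs → ∑[ x ∈ xs ] 𝟙 (P? x) ≡ 0
  ∑-𝟙-none []           = refl
  ∑-𝟙-none (¬px ∷ ¬pxs) = cong₂ _+_ (𝟙-no (P? _) ¬px) (∑-𝟙-none ¬pxs)

pred⁺ : ∀ {m} (i : Fin (suc m)) → 0 < Fin.toℕ i → Fin m
pred⁺ (Fin.suc i) _ = i

suc-pred⁺ : ∀ {m} (i : Fin (suc m)) (i>0 : 0 < Fin.toℕ i) → Fin.suc (pred⁺ i i>0) ≡ i
suc-pred⁺ (Fin.suc i) _ = refl

pred⁺-mono-< : ∀ {m} {i j : Fin (suc m)} {i>0 j>0} →
  i Fin.< j → pred⁺ i i>0 Fin.< pred⁺ j j>0
pred⁺-mono-< {i = Fin.suc _} {Fin.suc _} (s≤s i<j) = i<j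

<-pred⁺⇒suc< : ∀ {m} (i : Fin (suc m)) (i>0 : 0 < Fin.toℕ i) {j : Fin m} →
  j Fin.< pred⁺ i i>0 → Fin.suc j Fin.< i
<-pred⁺⇒suc< (Fin.suc i) _ j<i = s≤s j<i

module Functionals {c ℓ'} (F : FiniteField c ℓ') where
  open FiniteField F
    using (Carrier; _≈_; _≈?_; 0#; 1#; -_; +-cong; *-cong; zeroˡ; zeroʳ; *-identityʳ;
           +-identityˡ; -‿inverseˡ; setoid; ring; elems; complete; distinct; card)
    renaming (_+_ to _+ᶠ_; _*_ to _*ᶠ_; refl to ≈-refl; sym to ≈-sym; trans to ≈-trans)
  open LinAlg F
  open import Algebra.Properties.Ring ring using (+-inverseˡ-unique)
  module ≈-Reasoning = Relation.Binary.Reasoning.Setoid setoid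

  Σ-zero : ∀ n (f : Fin n → Carrier) → (∀ j → f j ≈ 0#) → Σ[< n ] f ≈ 0#
  Σ-zero zero    f f≈0 = ≈-refl
  Σ-zero (suc n) f f≈0 = begin
    f Fin.zero +ᶠ Σ[< n ] (λ j → f (Fin.suc j))
      ≈⟨ +-cong (f≈0 Fin.zero) (Σ-zero n _ (λ j → f≈0 (Fin.suc j))) ⟩
    0# +ᶠ 0#
      ≈⟨ +-identityˡ 0# ⟩
    0# ∎
    where open ≈-Reasoning

  a≈0⇒x*a+t≈t : ∀ x {a} t → a ≈ 0# → x *ᶠ a +ᶠ t ≈ t
  a≈0⇒x*a+t≈t x {a} t a≈0 = begin
    x *ᶠ a +ᶠ t  ≈⟨ +-cong (*-cong ≈-refl a≈0) ≈-refl ⟩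
    x *ᶠ 0# +ᶠ t ≈⟨ +-cong (zeroʳ x) ≈-refl ⟩
    0# +ᶠ t      ≈⟨ +-identityˡ t ⟩
    t            ∎
    where open ≈-Reasoning

  a≈1⇒x*a+t≈x+t : ∀ x {a} t → a ≈ 1# → x *ᶠ a +ᶠ t ≈ x +ᶠ t
  a≈1⇒x*a+t≈x+t x t a≈1 = +-cong (≈-trans (*-cong ≈-refl a≈1) (*-identityʳ x)) ≈-refl

  dropColumn : ∀ {k m} → Matrix k (suc m) → Matrix k m
  dropColumn R r j = R r (Fin.suc j)

  dropRow : ∀ {k m} → Matrix (suc k) m → Matrix k m
  dropRow R r = R (Fin.suc r)

  _·_ : ∀ {m} → Vector m → Vector m → Carrier
  _·_ {m} h v = Σ[< m ] λ j → h j *ᶠ v j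

  inKernel-cons-zeroColumn : ∀ {k m} {R : Matrix k (suc m)} x h →
    (∀ r → R r Fin.zero ≈ 0#) →
    InKernel (cons x h) R ⇔ InKernel h (dropColumn R)
  inKernel-cons-zeroColumn {R = R} x h R₀≈0 = mk⇔
    (λ K r → ≈-trans (≈-sym (absorb r)) (K r))
    (λ K r → ≈-trans (absorb r) (K r))
    where
    absorb : ∀ r → cons x h · R r ≈ h · dropColumn R r
    absorb r = a≈0⇒x*a+t≈t x _ (R₀≈0 r)

  inKernel-cons-pivotColumn : ∀ {k m} {R : Matrix (suc k) (suc m)} x h →
    R Fin.zero Fin.zero ≈ 1# → (∀ r → R (Fin.suc r) Fin.zero ≈ 0#) →
    InKernel (cons x h) R ⇔
    (x ≈ - (h · dropColumn R Fin.zero) × InKernel h (dropColumn (dropRow R)))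
  inKernel-cons-pivotColumn {R = R} x h R₀₀≈1 R₀≈0 = mk⇔
    (λ K → +-inverseˡ-unique x t (≈-trans (≈-sym pivotRow) (K Fin.zero))
         , λ r → ≈-trans (≈-sym (otherRow r)) (K (Fin.suc r)))
    λ { (x≈-t , K) Fin.zero    → ≈-trans pivotRow (≈-trans (+-cong x≈-t ≈-refl) (-‿inverseˡ t))
      ; (x≈-t , K) (Fin.suc r) → ≈-trans (otherRow r) (K r) }
    where
    t : Carrier
    t = h · dropColumn R Fin.zero
    pivotRow : cons x h · R Fin.zero ≈ x +ᶠ t
    pivotRow = a≈1⇒x*a+t≈x+t x t R₀₀≈1
    otherRow : ∀ r → cons x h · R (Fin.suc r) ≈ h · dropColumn (dropRow R) r
    otherRow r = a≈0⇒x*a+t≈t x _ (R₀≈0 r)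

  ∑-≈-elems : ∀ y → ∑[ x ∈ elems ] 𝟙 (x ≈? y) ≡ 1
  ∑-≈-elems y = exactlyOnce distinct (complete y)
    where
    exactlyOnce : ∀ {xs} → AllPairs (λ x z → ¬ x ≈ z) xs → Any (y ≈_) xs →
      ∑[ x ∈ xs ] 𝟙 (x ≈? y) ≡ 1
    exactlyOnce {x ∷ _} (x≉xs ∷ _) (here y≈x) = cong₂ _+_
      (𝟙-yes (x ≈? y) (≈-sym y≈x))
      (∑-𝟙-none (_≈? y)
        (All.map (λ x≉z z≈y → x≉z (≈-trans (≈-sym y≈x) (≈-sym z≈y))) x≉xs))
    exactlyOnce {x ∷ _} (x≉xs ∷ xs-distinct) (there y∈xs) = cong₂ _+_
      (𝟙-no (x ≈? y) (λ x≈y →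
        All.lookupWith (λ x≉z y≈z → x≉z (≈-trans x≈y y≈z)) x≉xs y∈xs))
      (exactlyOnce xs-distinct y∈xs)

  data Echelon : (k m : ℕ) → Matrix k m → Set (c ⊔ ℓ') where
    []          : ∀ {m} {R : Matrix 0 m} → Echelon 0 m R
    zeroColumn  : ∀ {k m} {R : Matrix k (suc m)} →
                  (∀ r → R r Fin.zero ≈ 0#) → Echelon k m (dropColumn R) → Echelon k (suc m) R
    pivotColumn : ∀ {k m} {R : Matrix (suc k) (suc m)} →
                  R Fin.zero Fin.zero ≈ 1# → (∀ r → R (Fin.suc r) Fin.zero ≈ 0#) →
                  Echelon k m (dropColumn (dropRow R)) → Echelon (suc k) (suc m) R

  Echelon⇒≤ : ∀ {k m R} → Echelon k m R → k ≤ m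
  Echelon⇒≤ []                  = z≤n
  Echelon⇒≤ (zeroColumn _ E)    = ℕ.m≤n⇒m≤1+n (Echelon⇒≤ E)
  Echelon⇒≤ (pivotColumn _ _ E) = s≤s (Echelon⇒≤ E)

  record RowEchelonWith {k m} (M : Matrix k m) (p : Fin k → Fin m) : Set ℓ' where
    field
      increasing   : Increasing p
      pivot≈1      : ∀ r → M r (p r) ≈ 1#
      leadingZeros : ∀ r j → j Fin.< p r → M r j ≈ 0#

  module _ {k m} {M : Matrix k (suc m)} {p : Fin k → Fin (suc m)} (E : RowEchelonWith M p)
           (p>0 : ∀ r → 0 < Fin.toℕ (p r)) where
    open RowEchelonWith E

    firstColumn≈0 : ∀ r → M r Fin.zero ≈ 0#
    firstColumn≈0 r = leadingZeros r Fin.zero (p>0 r)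

    dropColumn-rowEchelon : RowEchelonWith (dropColumn M) (λ r → pred⁺ (p r) (p>0 r))
    dropColumn-rowEchelon = record
      { increasing   = λ r s r<s → pred⁺-mono-< (increasing r s r<s)
      ; pivot≈1      = λ r →
          subst (λ j → M r j ≈ 1#) (sym (suc-pred⁺ (p r) (p>0 r))) (pivot≈1 r)
      ; leadingZeros = λ r j j<p →
          leadingZeros r (Fin.suc j) (<-pred⁺⇒suc< (p r) (p>0 r) j<p)
      }

  dropRow-rowEchelon : ∀ {k m} {M : Matrix (suc k) m} {p} → RowEchelonWith M p →
    RowEchelonWith (dropRow M) (λ r → p (Fin.suc r))
  dropRow-rowEchelon E = record
    { increasing   = λ r s r<s → increasing (Fin.suc r) (Fin.suc s) (s≤s r<s)
    ; pivot≈1      = λ r → pivot≈1 (Fin.suc r)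
    ; leadingZeros = λ r → leadingZeros (Fin.suc r)
    }
    where open RowEchelonWith E

  rowEchelon⇒Echelon : ∀ {k m} {M : Matrix k m} {p} → RowEchelonWith M p → Echelon k m M
  rowEchelon⇒Echelon {zero} E = []
  rowEchelon⇒Echelon {suc k} {zero} {p = p} E with p Fin.zero
  ... | ()
  rowEchelon⇒Echelon {suc k} {suc m} {M} {p} E with p Fin.zero in p₀≡
  ... | Fin.zero = pivotColumn
    (subst (λ j → M Fin.zero j ≈ 1#) p₀≡ (pivot≈1 Fin.zero))
    (firstColumn≈0 E' p>0)
    (rowEchelon⇒Echelon (dropColumn-rowEchelon E' p>0))
    where
    open RowEchelonWith E
    E' : RowEchelonWith (dropRow M) (λ r → p (Fin.suc r))
    E' = dropRow-rowEchelon E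
    p>0 : ∀ r → 0 < Fin.toℕ (p (Fin.suc r))
    p>0 r = subst (Fin._< p (Fin.suc r)) p₀≡ (increasing Fin.zero (Fin.suc r) (s≤s z≤n))
  ... | Fin.suc _ =
    zeroColumn (firstColumn≈0 E p>0) (rowEchelon⇒Echelon (dropColumn-rowEchelon E p>0))
    where
    open RowEchelonWith E
    p>0 : ∀ r → 0 < Fin.toℕ (p r)
    p>0 Fin.zero    rewrite p₀≡ = s≤s z≤n
    p>0 (Fin.suc r) = ℕ.≤-trans (s≤s z≤n) (increasing Fin.zero (Fin.suc r) (s≤s z≤n))

  rref⇒Echelon : ∀ {k m} {M : Matrix k m} → IsRREF M → Echelon k m M
  rref⇒Echelon {k} {m} isRREF =
    let p , p∈incMaps , (pivot≈1 , leadingZeros , _) = find isRREF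
    in rowEchelon⇒Echelon {p = p} record
      { increasing   = proj₂ (∈-filter⁻ increasing? {xs = allFuns k (allFin m)} p∈incMaps)
      ; pivot≈1      = pivot≈1
      ; leadingZeros = leadingZeros
      }

  functionals : (m : ℕ) → List (Vector m)
  functionals m = allFuns m elems

  ∑-inKernel-echelon : ∀ {k m R} → Echelon k m R →
    ∑[ h ∈ functionals m ] 𝟙 (inKernel? h R) ≡ card ^ (m ∸ k)
  ∑-inKernel-echelon {m = m} {R} [] =
    trans (∑-cong (functionals m) (λ h → 𝟙-yes (inKernel? h R) (λ ()))) (∑-allFuns-1 m elems)
  ∑-inKernel-echelon {k} {suc m} {R} (zeroColumn R₀≈0 E) = begin
    ∑[ h ∈ functionals (suc m) ] 𝟙 (inKernel? h R)
      ≡⟨ ∑-allFuns-suc m elems _ ⟩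
    ∑[ x ∈ elems ] ∑[ h ∈ functionals m ] 𝟙 (inKernel? (cons x h) R)
      ≡⟨ ∑-cong elems (λ x → ∑-cong (functionals m) (λ h →
           𝟙-cong (inKernel? (cons x h) R) (inKernel? h (dropColumn R))
                  (inKernel-cons-zeroColumn {R = R} x h R₀≈0))) ⟩
    ∑[ x ∈ elems ] ∑[ h ∈ functionals m ] 𝟙 (inKernel? h (dropColumn R))
      ≡⟨ ∑-cong elems (λ _ → ∑-inKernel-echelon E) ⟩
    ∑[ x ∈ elems ] card ^ (m ∸ k)
      ≡⟨ ∑-const elems _ ⟩
    card ^ (1 + (m ∸ k))
      ≡⟨ cong (card ^_) (ℕ.+-∸-assoc 1 (Echelon⇒≤ E)) ⟨
    card ^ (suc m ∸ k) ∎
    where open ≡-Reasoning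
  ∑-inKernel-echelon {suc k} {suc m} {R} (pivotColumn R₀₀≈1 R₀≈0 E) = begin
    ∑[ h ∈ functionals (suc m) ] 𝟙 (inKernel? h R)
      ≡⟨ ∑-allFuns-suc m elems _ ⟩
    ∑[ x ∈ elems ] ∑[ h ∈ functionals m ] 𝟙 (inKernel? (cons x h) R)
      ≡⟨ ∑-cong elems (λ x → ∑-cong (functionals m) (λ h → trans
           (𝟙-cong (inKernel? (cons x h) R) (x ≈? pivot h ×-dec inKernel? h R')
                   (inKernel-cons-pivotColumn {R = R} x h R₀₀≈1 R₀≈0))
           (𝟙-× (x ≈? pivot h) (inKernel? h R')))) ⟩
    ∑[ x ∈ elems ] ∑[ h ∈ functionals m ] 𝟙 (x ≈? pivot h) * 𝟙 (inKernel? h R')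
      ≡⟨ ∑-comm elems (functionals m) _ ⟩
    ∑[ h ∈ functionals m ] ∑[ x ∈ elems ] 𝟙 (x ≈? pivot h) * 𝟙 (inKernel? h R')
      ≡⟨ ∑-cong (functionals m) (λ h → trans (∑-*ʳ elems _ _)
           (trans (cong (_* 𝟙 (inKernel? h R')) (∑-≈-elems (pivot h))) (ℕ.*-identityˡ _))) ⟩
    ∑[ h ∈ functionals m ] 𝟙 (inKernel? h R')
      ≡⟨ ∑-inKernel-echelon E ⟩
    card ^ (m ∸ k) ∎
    where
    open ≡-Reasoning
    R' : Matrix k m
    R' = dropColumn (dropRow R)
    pivot : Vector m → Carrier
    pivot h = - (h · dropColumn R Fin.zero)

  IsZero : ∀ {m} → Vector m → Set ℓ'
  IsZero h = ∀ j → h j ≈ 0#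

  isZero? : ∀ {m} → Decidable (IsZero {m})
  isZero? h = all? λ j → h j ≈? 0#

  IsNonzero : ∀ {m} → Vector m → Set ℓ'
  IsNonzero {m} h = Any (λ j → ¬ h j ≈ 0#) (allFin m)

  isNonzero? : ∀ {m} → Decidable (IsNonzero {m})
  isNonzero? h = Any.any? (λ j → ¬? (h j ≈? 0#)) (allFin _)

  nonzero⇒¬zero : ∀ {m} {h : Vector m} → IsNonzero h → ¬ IsZero h
  nonzero⇒¬zero nz z = let j , hj≉0 = Any.satisfied nz in hj≉0 (z j)

  ¬nonzero⇒zero : ∀ {m} {h : Vector m} → ¬ IsNonzero h → IsZero h
  ¬nonzero⇒zero {h = h} ¬nz j =
    decidable-stable (h j ≈? 0#) (λ hj≉0 → ¬nz (lose (∈-allFin j) hj≉0))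

  zero⇒inKernel : ∀ {k m} {h : Vector m} (M : Matrix k m) → IsZero h → InKernel h M
  zero⇒inKernel {m = m} M z r = Σ-zero m _ (λ j → ≈-trans (*-cong (z j) ≈-refl) (zeroˡ (M r j)))

  isZero-cons : ∀ {m} x (h : Vector m) → IsZero (cons x h) ⇔ (x ≈ 0# × IsZero h)
  isZero-cons x h = mk⇔
    (λ z → z Fin.zero , λ j → z (Fin.suc j))
    (λ { (x≈0 , z) Fin.zero → x≈0 ; (x≈0 , z) (Fin.suc j) → z j })

  ∑-isZero : ∀ m → ∑[ h ∈ functionals m ] 𝟙 (isZero? h) ≡ 1
  ∑-isZero zero    = refl
  ∑-isZero (suc m) = begin
    ∑[ h ∈ functionals (suc m) ] 𝟙 (isZero? h)
      ≡⟨ ∑-allFuns-suc m elems _ ⟩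
    ∑[ x ∈ elems ] ∑[ h ∈ functionals m ] 𝟙 (isZero? (cons x h))
      ≡⟨ ∑-cong elems (λ x → ∑-cong (functionals m) (λ h →
           trans (𝟙-cong (isZero? (cons x h)) (x ≈? 0# ×-dec isZero? h) (isZero-cons x h))
                 (𝟙-× (x ≈? 0#) (isZero? h)))) ⟩
    ∑[ x ∈ elems ] ∑[ h ∈ functionals m ] 𝟙 (x ≈? 0#) * 𝟙 (isZero? h)
      ≡⟨ ∑-cong elems (λ x → trans (∑-*ˡ (functionals m) (𝟙 (x ≈? 0#)) (λ h → 𝟙 (isZero? h)))
           (trans (cong (𝟙 (x ≈? 0#) *_) (∑-isZero m)) (ℕ.*-identityʳ _))) ⟩
    ∑[ x ∈ elems ] 𝟙 (x ≈? 0#)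
      ≡⟨ ∑-≈-elems 0# ⟩
    1 ∎
    where open ≡-Reasoning

  nonzeroFunctionals : (m : ℕ) → List (Vector m)
  nonzeroFunctionals m = filter isNonzero? (functionals m)

  all-nonzeroFunctionals : ∀ {m p} {P : Vector m → Set p} →
    (∀ (h : NonzeroFunctional m) → P (proj₁ h)) → All P (nonzeroFunctionals m)
  all-nonzeroFunctionals {m} P-nonzero =
    All.map (λ {h} nz → P-nonzero (h , nz)) (all-filter isNonzero? (functionals m))

  ∑-𝟙-nonzeroFunctionals : ∀ {m p} {P : Vector m → Set p} (P? : Decidable P) →
    (∀ {h} → IsZero h → P h) →
    ∑[ h ∈ nonzeroFunctionals m ] 𝟙 (P? h) ≡ (∑[ h ∈ functionals m ] 𝟙 (P? h)) ∸ 1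
  ∑-𝟙-nonzeroFunctionals {m} P? P-zero = trans (sym (ℕ.m+n∸n≡m _ 1)) (cong (_∸ 1) (begin
    (∑[ h ∈ nonzeroFunctionals m ] 𝟙 (P? h)) + 1
      ≡⟨ cong₂ _+_ (∑-filter isNonzero? (functionals m) _) (sym (∑-isZero m)) ⟩
    (∑[ h ∈ functionals m ] 𝟙 (isNonzero? h) * 𝟙 (P? h))
      + (∑[ h ∈ functionals m ] 𝟙 (isZero? h))
      ≡⟨ ∑-+ (functionals m) _ _ ⟨
    ∑[ h ∈ functionals m ] (𝟙 (isNonzero? h) * 𝟙 (P? h) + 𝟙 (isZero? h))
      ≡⟨ ∑-cong (functionals m) split ⟨
    ∑[ h ∈ functionals m ] 𝟙 (P? h) ∎))
    where
    open ≡-Reasoning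
    split : ∀ h → 𝟙 (P? h) ≡ 𝟙 (isNonzero? h) * 𝟙 (P? h) + 𝟙 (isZero? h)
    split h with isNonzero? h
    ... | yes nz  = sym (begin
      1 * 𝟙 (P? h) + 𝟙 (isZero? h) ≡⟨ cong (1 * 𝟙 (P? h) +_) (𝟙-no (isZero? h) (nonzero⇒¬zero nz)) ⟩
      1 * 𝟙 (P? h) + 0             ≡⟨ ℕ.+-identityʳ _ ⟩
      1 * 𝟙 (P? h)                 ≡⟨ ℕ.*-identityˡ _ ⟩
      𝟙 (P? h)                     ∎)
    ... | no ¬nz  = let z = ¬nonzero⇒zero ¬nz in
      trans (𝟙-yes (P? h) (P-zero z)) (sym (𝟙-yes (isZero? h) z))

  length-nonzeroFunctionals : ∀ m → length (nonzeroFunctionals m) ≡ card ^ m ∸ 1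
  length-nonzeroFunctionals m = begin
    length (nonzeroFunctionals m)        ≡⟨ ℕ.*-identityʳ _ ⟨
    length (nonzeroFunctionals m) * 1    ≡⟨ ∑-const (nonzeroFunctionals m) 1 ⟨
    ∑[ h ∈ nonzeroFunctionals m ] 1      ≡⟨ ∑-𝟙-nonzeroFunctionals {m} (λ _ → yes tt) (λ _ → tt) ⟩
    (∑[ h ∈ functionals m ] 1) ∸ 1       ≡⟨ cong (_∸ 1) (∑-allFuns-1 m elems) ⟩
    card ^ m ∸ 1                         ∎
    where open ≡-Reasoning

  ∑-inKernel-nonzero : ∀ {k m R} → Echelon k m R →
    ∑[ h ∈ nonzeroFunctionals m ] 𝟙 (inKernel? h R) ≡ card ^ (m ∸ k) ∸ 1
  ∑-inKernel-nonzero {R = R} E =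
    trans (∑-𝟙-nonzeroFunctionals (λ h → inKernel? h R) (zero⇒inKernel R))
          (cong (_∸ 1) (∑-inKernel-echelon E))

  ∑-gIntΠIn : ∀ {ℓ m} (Π : Hyperplane ℓ m) →
    ∑[ h ∈ nonzeroFunctionals m ] gIntΠIn Π h ≡ gIntΠ Π * (card ^ (m ∸ ℓ) ∸ 1)
  ∑-gIntΠIn {ℓ} {m} Π = begin
    ∑[ h ∈ N ] gIntΠIn Π h
      ≡⟨ ∑-cong N (λ h → count≡∑𝟙 (incident? h) Ms) ⟩
    ∑[ h ∈ N ] ∑[ M ∈ Ms ] 𝟙 (incident? h M)
      ≡⟨ ∑-comm N Ms _ ⟩
    ∑[ M ∈ Ms ] ∑[ h ∈ N ] 𝟙 (incident? h M)
      ≡⟨ ∑-cong Ms countKernels ⟩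
    ∑[ M ∈ Ms ] 𝟙 (isRREF? M ×-dec inΠ? Π M) * κ
      ≡⟨ ∑-*ʳ Ms κ _ ⟩
    (∑[ M ∈ Ms ] 𝟙 (isRREF? M ×-dec inΠ? Π M)) * κ
      ≡⟨ cong (_* κ) (count≡∑𝟙 (λ M → isRREF? M ×-dec inΠ? Π M) Ms) ⟨
    gIntΠ Π * κ ∎
    where
    open ≡-Reasoning
    Ms : List (Matrix ℓ m)
    Ms = allMatrices ℓ m
    N : List (Vector m)
    N = nonzeroFunctionals m
    κ : ℕ
    κ = card ^ (m ∸ ℓ) ∸ 1
    incident? : ∀ h M → Dec (IsRREF M × InΠ Π M × InKernel h M)
    incident? h M = isRREF? M ×-dec (inΠ? Π M ×-dec inKernel? h M)
    countKernels : ∀ M → ∑[ h ∈ N ] 𝟙 (incident? h M) ≡ 𝟙 (isRREF? M ×-dec inΠ? Π M) * κ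
    countKernels M with isRREF? M
    ... | no _     = ∑-zero N
    ... | yes rref = begin
      ∑[ h ∈ N ] 𝟙 (inΠ? Π M ×-dec inKernel? h M)
        ≡⟨ ∑-cong N (λ h → 𝟙-× (inΠ? Π M) (inKernel? h M)) ⟩
      ∑[ h ∈ N ] 𝟙 (inΠ? Π M) * 𝟙 (inKernel? h M)
        ≡⟨ ∑-*ˡ N (𝟙 (inΠ? Π M)) (λ h → 𝟙 (inKernel? h M)) ⟩
      𝟙 (inΠ? Π M) * (∑[ h ∈ N ] 𝟙 (inKernel? h M))
        ≡⟨ cong (𝟙 (inΠ? Π M) *_) (∑-inKernel-nonzero (rref⇒Echelon rref)) ⟩
      𝟙 (inΠ? Π M) * κ ∎

lemma4p1 : ∀ {c ℓ'} (F : FiniteField c ℓ') (ℓ m : ℕ) →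
    1 ≤ ℓ → ℓ ≤ m ∸ 1 →
    (Π : LinAlg.Hyperplane F ℓ m) (a : ℕ) →
    -- a = max over hyperplanes V_{m-1} = ker h of |Π ∩ G(ℓ, V_{m-1})|
    (∀ (h : LinAlg.NonzeroFunctional F m) → LinAlg.gIntΠIn F Π (proj₁ h) ≤ a) →
    (∃ λ (h : LinAlg.NonzeroFunctional F m) → LinAlg.gIntΠIn F Π (proj₁ h) ≡ a) →
    let q = FiniteField.card F in
    (LinAlg.gIntΠ F Π * (q ^ (m ∸ ℓ) ∸ 1) ≤ a * (q ^ m ∸ 1))
    × ((∀ (h : LinAlg.NonzeroFunctional F m) → LinAlg.gIntΠIn F Π (proj₁ h) ≡ a) →
       LinAlg.gIntΠ F Π * (q ^ (m ∸ ℓ) ∸ 1) ≡ a * (q ^ m ∸ 1))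
lemma4p1 F ℓ m _ _ Π a gIntΠIn≤a _ = upperBound , λ gIntΠIn≡a →
  trans (sym (∑-gIntΠIn Π)) (trans (∑-cong-All (all-nonzeroFunctionals gIntΠIn≡a)) ∑-a)
  where
  open Functionals F
  open LinAlg F using (gIntΠ; gIntΠIn)
  q : ℕ
  q = FiniteField.card F
  N : List (LinAlg.Vector F m)
  N = nonzeroFunctionals m

  ∑-a : ∑[ h ∈ N ] a ≡ a * (q ^ m ∸ 1)
  ∑-a = trans (∑-const N a) (trans (cong (_* a) (length-nonzeroFunctionals m)) (ℕ.*-comm _ a))

  upperBound : gIntΠ Π * (q ^ (m ∸ ℓ) ∸ 1) ≤ a * (q ^ m ∸ 1)
  upperBound = begin
    gIntΠ Π * (q ^ (m ∸ ℓ) ∸ 1) ≡⟨ ∑-gIntΠIn Π ⟨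
    ∑[ h ∈ N ] gIntΠIn Π h      ≤⟨ ∑-mono-≤ (all-nonzeroFunctionals gIntΠIn≤a) ⟩
    ∑[ h ∈ N ] a                ≡⟨ ∑-a ⟩
    a * (q ^ m ∸ 1)             ∎
    where open ℕ.≤-Reasoning
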